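{- Let \(G=(V,E)\) be a graph on \(n\) vertices, \((T,\mathcal{X})\) a tree decomposition of \(G\) with \(\mathcal{X}=(X^i)_{i\in V(T)}\), and \(P\subseteq T\) a path with node set \(V_P\) and ends \(i_0\), \(j_0\), where \(i_0\) is a nonredundant end of \(P\). Fix a \(P\)-labeling of \(G\) (with respect to \(i_0\)) and identify each vertex with its label. Let \(i\in V_P\) be arbitrary, and let \(i^-\) and \(i^+\) be the nodes before and after \(i\) on \(P\), respectively. Let \(x^-\) be the vertex with the largest label in \(R_{i^- }\) and \(x^+\) the vertex with the smallest label in \(S_{i^+}\cup R_{i^+}\). Let \(V_P^-\) be the set of nodes of the subpath of \(P\) from \(i_0\) to \(i\), other than \(i\), and \(V_P^+\) the set of nodes of the subpath of \(P\) from \(i\) to \(j_0\), other than \(i\). Then removing from \(G\) the edge set \(E_G(i)\) decomposes \(G\) into the following pairwise disjoint parts (vertex-disjoint subgraphs with no edges of \(G-E_G(i)\) between them, together covering \(V\)): - an isolated vertex for each \(v\in R_i\); - if \(S_i\neq\emptyset\), the subgraph \(G[S_i]\); - if \(i\neq i_0\), the subgraph of \(G\) induced by \(\bigcup_{j\in V_P^- }(R_j\cup S_j)=\{1,\dots,x^-\}\); - if \(i\neq j_0\), the subgraph of \(G\) induced by \(\bigcup_{j\in V_P^+}(R_j\cup S_j)=\{x^+,\dots,n\}\).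
   Context: A tree decomposition of \(G\) is a pair \((T,\mathcal{X})\) with \(T\) a tree and \(X^i\subseteq V\) such that every vertex lies in some \(X^i\), every edge is contained in some \(X^i\), and \(X^i\cap X^j\subseteq X^h\) whenever \(h\) lies on the \(i\)–\(j\) path in \(T\). For a path \(P=(i_0,\dots,i_\ell)\), \(i_0\) is a nonredundant end if \(X^{i_0}\neq\emptyset\) and \(X^{i_h}\not\subseteq X^{i_{h-1}}\) for all \(h\in\{1,\dots,\ell\}\). For a node \(i\), \(E_G(i)\) is the set of edges \(e\in E\) with \(e\cap X^i\neq\emptyset\). For \(i\in V_P\), \(T_i\) is the component of \(T-E(P)\) containing \(i\). \(R:=\bigcup_{i\in V_P}X^i\). For \(x\in R\), its path node is the node \(i\in V_P\) closest to \(i_0\) with \(x\in X^i\); \(R_i:=\{x\in X^i: i\text{ is the path node of }x\}\) and \(S_i:=\bigcup_{j\in V(T_i)}X^j\setminus R\). A \(P\)-labeling is a bijective labeling of \(V\) with \(1,\dots,n\) such that (i) for each \(i\in V_P\), the vertices of \(R_i\cup S_i\) receive consecutive labels, with those of \(R_i\) receiving the largest labels among them, and (ii) for distinct \(i,j\in V_P\) with \(i\) closer to \(i_0\) than \(j\), every vertex of \(R_i\cup S_i\) has a smaller label than every vertex of \(R_j\cup S_j\). For \(i\in V_P\setminus\{j_0\}\), the node after \(i\) on \(P\) is its neighbor on \(P\) further from \(i_0\), and \(i\) is then the node before it; moreover \(i_0\) is defined to be the node after \(j_0\) and \(j_0\) the node before \(i_0\). -}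

module Defs where

open import Data.Nat using (ℕ; zero; suc; _+_)
open import Data.Fin using (Fin; zero; suc; inject₁; fromℕ; toℕ) renaming (_<_ to _<F_; _≤_ to _≤F_)
open import Data.Bool using (Bool; true; false)
open import Data.Product using (Σ; ∃; ∃-syntax; _×_; _,_)
open import Data.Sum using (_⊎_)
open import Relation.Nullary using (¬_)
open import Relation.Binary.PropositionalEquality using (_≡_)
open import Relation.Binary.Construct.Closure.ReflexiveTransitive using (Star)
open import Function.Definitions using (Injective; Surjective)

record Graph (n : ℕ) : Set where
  field
    adj    : Fin n → Fin n → Bool
    sym    : ∀ u v → adj u v ≡ adj v u
    irrefl : ∀ v → adj v v ≡ false

open Graph public

Edge : ∀ {n} → Graph n → Fin n → Fin n → Set
Edge G u v = adj G u v ≡ true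

IsPath : ∀ {n k} → Graph n → (Fin (suc k) → Fin n) → Set
IsPath {n} {k} G w =
  Injective _≡_ _≡_ w × (∀ (j : Fin k) → Edge G (w (inject₁ j)) (w (suc j)))

IsCycle : ∀ {n k} → Graph n → (Fin (3 + k) → Fin n) → Set
IsCycle {n} {k} G c =
  Injective _≡_ _≡_ c
  × (∀ (j : Fin (2 + k)) → Edge G (c (inject₁ j)) (c (suc j)))
  × Edge G (c (fromℕ (2 + k))) (c zero)

Connected : ∀ {n} → Graph n → Set
Connected G = ∀ u v → Star (Edge G) u v

Acyclic : ∀ {n} → Graph n → Set
Acyclic {n} G = ∀ (k : ℕ) (c : Fin (3 + k) → Fin n) → ¬ IsCycle G c

IsTree : ∀ {m} → Graph m → Set
IsTree T = Connected T × Acyclic T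

OnPath : ∀ {m} → Graph m → Fin m → Fin m → Fin m → Set
OnPath {m} T i j h =
  Σ ℕ λ k → Σ (Fin (suc k) → Fin m) λ w →
    IsPath T w × w zero ≡ i × w (fromℕ k) ≡ j × ∃[ s ] w s ≡ h

record TreeDecomp {n m : ℕ} (G : Graph n) (T : Graph m) : Set where
  field
    isTree   : IsTree T
    bag      : Fin m → Fin n → Bool
    cover-v  : ∀ v → ∃[ t ] bag t v ≡ true
    cover-e  : ∀ u v → Edge G u v → ∃[ t ] (bag t u ≡ true × bag t v ≡ true)
    coherent : ∀ i j h → OnPath T i j h →
               ∀ x → bag i x ≡ true → bag j x ≡ true → bag h x ≡ true

open TreeDecomp public

module _ {n m ℓ : ℕ} {G : Graph n} {T : Graph m}
         (D : TreeDecomp G T) (p : Fin (suc ℓ) → Fin m) where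

  _∈X_ : Fin n → Fin m → Set
  x ∈X t = bag D t x ≡ true

  -- i₀ = p zero is a nonredundant end of the path P = (p 0, …, p ℓ)
  NonredundantEnd : Set
  NonredundantEnd =
    (∃[ x ] x ∈X p zero)
    × (∀ (h : Fin ℓ) → ¬ (∀ x → x ∈X p (suc h) → x ∈X p (inject₁ h)))

  InR : Fin n → Set
  InR x = ∃[ k ] x ∈X p k

  -- x ∈ R_{p k}: p k is the path node of x (closest to i₀ containing x)
  InRᵢ : Fin (suc ℓ) → Fin n → Set
  InRᵢ k x = x ∈X p k × (∀ k' → k' <F k → ¬ (x ∈X p k'))

  PEdge : Fin m → Fin m → Set
  PEdge a b = ∃[ j ] ((a ≡ p (inject₁ j) × b ≡ p (suc j))
                      ⊎ (b ≡ p (inject₁ j) × a ≡ p (suc j)))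

  -- t is a node of T_{p k}, the component of T - E(P) containing p k
  InTᵢ : Fin (suc ℓ) → Fin m → Set
  InTᵢ k t = Star (λ a b → Edge T a b × ¬ PEdge a b) (p k) t

  InSᵢ : Fin (suc ℓ) → Fin n → Set
  InSᵢ k x = (∃[ t ] (InTᵢ k t × x ∈X t)) × ¬ InR x

  InRSᵢ : Fin (suc ℓ) → Fin n → Set
  InRSᵢ k x = InRᵢ k x ⊎ InSᵢ k x

  -- P-labeling: a bijection V → {1,…,n}, represented as lab : Fin n → Fin n
  -- (label of v is toℕ (lab v) + 1; label order = Fin order)
  record IsPLabeling (lab : Fin n → Fin n) : Set where
    field
      injective   : Injective _≡_ _≡_ lab
      surjective  : Surjective _≡_ _≡_ lab
      consecutive : ∀ k u v w → InRSᵢ k u → InRSᵢ k w →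
                    lab u ≤F lab v → lab v ≤F lab w → InRSᵢ k v
      R-largest   : ∀ k u v → InRᵢ k u → InSᵢ k v → lab v <F lab u
      ordered     : ∀ k k' → k <F k' → ∀ u v → InRSᵢ k u → InRSᵢ k' v →
                    lab u <F lab v

  Before : Fin (suc ℓ) → Fin n → Set
  Before k v = ∃[ k' ] (k' <F k × InRSᵢ k' v)

  After : Fin (suc ℓ) → Fin n → Set
  After k v = ∃[ k' ] (k <F k' × InRSᵢ k' v)

  EdgeMinus : Fin (suc ℓ) → Fin n → Fin n → Set
  EdgeMinus k u v = Edge G u v × ¬ (u ∈X p k) × ¬ (v ∈X p k)

  record Decomposition (lab : Fin n → Fin n) (k : Fin (suc ℓ)) : Set where
    field
      cover     : ∀ v → InRᵢ k v ⊎ InSᵢ k v ⊎ Before k v ⊎ After k v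
      disj-R-S  : ∀ v → ¬ (InRᵢ k v × InSᵢ k v)
      disj-R-B  : ∀ v → ¬ (InRᵢ k v × Before k v)
      disj-R-A  : ∀ v → ¬ (InRᵢ k v × After k v)
      disj-S-B  : ∀ v → ¬ (InSᵢ k v × Before k v)
      disj-S-A  : ∀ v → ¬ (InSᵢ k v × After k v)
      disj-B-A  : ∀ v → ¬ (Before k v × After k v)
      R-isolated : ∀ v u → InRᵢ k v → ¬ EdgeMinus k v u
      -- every edge of G - E_G(i) lies inside one of the parts
      -- (so there are no edges between different parts)
      edges-inside : ∀ u v → EdgeMinus k u v →
                     (InSᵢ k u × InSᵢ k v) ⊎ (Before k u × Before k v)
                     ⊎ (After k u × After k v)
      -- if i ≠ i₀ (k = suc k₀, i⁻ = p (inject₁ k₀)) and x⁻ is the vertex of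
      -- largest label in R_{i⁻}, the "before" part is {1,…,x⁻}
      before-interval : ∀ (k₀ : Fin ℓ) → k ≡ suc k₀ →
                        ∀ x → InRᵢ (inject₁ k₀) x →
                        (∀ y → InRᵢ (inject₁ k₀) y → lab y ≤F lab x) →
                        ∀ v → (Before k v → lab v ≤F lab x)
                              × (lab v ≤F lab x → Before k v)
      -- if i ≠ j₀ (k = inject₁ k₀, i⁺ = p (suc k₀)) and x⁺ is the vertex of
      -- smallest label in S_{i⁺} ∪ R_{i⁺}, the "after" part is {x⁺,…,n}
      after-interval : ∀ (k₀ : Fin ℓ) → k ≡ inject₁ k₀ →
                       ∀ x → InRSᵢ (suc k₀) x →
                       (∀ y → InRSᵢ (suc k₀) y → lab x ≤F lab y) →
                       ∀ v → (After k v → lab x ≤F lab v)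
                             × (lab x ≤F lab v → After k v)

module Submission where

-- Removing the j-th edge
-- {p j, p (j+1)} of P separates every component T_a (a ≤ j) of T − E(P)
-- from every T_c (c > j): a walk between them avoiding that edge, together
-- with pieces of P and of T_a, T_c, would join the ends of the edge, and in
-- an acyclic graph such a walk shortens to a cycle ('bridge', 'crossing').
-- If y ∉ X^{p k}, the path of T between two bags of y stays in bags of y
-- (coherence), hence avoids the node p k and an edge of P at it; so y's
-- bags lie in components on one side of k ('no-jump', 'stays-…').  This
-- gives 'edges-inside' without using the labeling.  The labeling makes the
-- blocks R_a ∪ S_a pairwise disjoint and ordered, which yields the
-- disjointness and interval statements.

open import Defs
open import Data.Nat using (ℕ; zero; suc; _≤_; _<_; z≤n; s≤s; s≤s⁻¹)
open import Data.Nat.Properties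
  using (≤-refl; ≤-reflexive; <⇒≤; <-≤-trans; ≤-<-trans; <-trans; <-irrefl; <-asym; ≮⇒≥; <⇒≱; _<?_)
open import Data.Fin using (Fin; zero; suc; toℕ; inject₁; fromℕ)
  renaming (_<_ to _<F_; _≤_ to _≤F_)
import Data.Fin.Properties as Fin
open import Data.Bool using (true)
import Data.Bool.Properties as Bool
open import Data.List using (List; []; _∷_; length; lookup)
open import Data.List.Membership.Propositional using (_∈_; _∉_)
open import Data.List.Membership.Propositional.Properties using (∈-lookup)
open import Data.List.Relation.Unary.Any using (here; there; index)
open import Data.List.Relation.Unary.Any.Properties using (lookup-index)
open import Data.Unit using (⊤; tt)
open import Data.Product using (∃; ∃-syntax; _×_; _,_; proj₁; proj₂)
open import Data.Sum using (_⊎_; inj₁; inj₂; [_,_]′)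
import Data.Sum as Sum
open import Data.Empty using (⊥; ⊥-elim)
open import Function using (_∘_)
open import Function.Definitions using (Injective)
open import Relation.Nullary using (¬_; Dec; yes; no)
open import Relation.Binary using (DecidableEquality; tri<; tri≈; tri>)
open import Relation.Binary.PropositionalEquality using (_≡_; _≢_; refl; cong; subst; trans)
import Relation.Binary.PropositionalEquality as ≡
open import Relation.Binary.Construct.Closure.ReflexiveTransitive using (Star; ε; _◅_; _◅◅_)
import Relation.Binary.Construct.Closure.ReflexiveTransitive as ⋆

climb : ∀ {A : Set} {ℓ} (p : Fin (suc ℓ) → A) {R : A → A → Set} (a b : Fin (suc ℓ)) →
        toℕ a ≤ toℕ b →
        (∀ (h : Fin ℓ) → toℕ a ≤ toℕ h → toℕ h < toℕ b → R (p (inject₁ h)) (p (suc h))) →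
        Star R (p a) (p b)
climb p zero zero _ _ = ε
climb {ℓ = zero} p zero (suc ()) _ _
climb {ℓ = suc ℓ} p zero (suc b) _ step =
  step zero z≤n (s≤s z≤n) ◅ climb (p ∘ suc) zero b z≤n (λ h _ h<b → step (suc h) z≤n (s≤s h<b))
climb {ℓ = suc ℓ} p (suc a) (suc b) (s≤s a≤b) step =
  climb (p ∘ suc) a b a≤b (λ h a≤h h<b → step (suc h) (s≤s a≤h) (s≤s h<b))

incident-step : ∀ {ℓ} (a k c : Fin (suc ℓ)) → toℕ a < toℕ c → toℕ a ≤ toℕ k → toℕ k ≤ toℕ c →
                ∃[ j ] (inject₁ j ≡ k ⊎ suc j ≡ k) × toℕ a ≤ toℕ j × toℕ j < toℕ c
incident-step {suc ℓ} zero zero (suc c) _ _ _ = zero , inj₁ refl , z≤n , s≤s z≤n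
incident-step {zero} zero zero zero () _ _
incident-step zero (suc k) c _ _ k≤c = k , inj₂ refl , z≤n , k≤c
incident-step {suc ℓ} (suc a) (suc k) (suc c) (s≤s a<c) (s≤s a≤k) (s≤s k≤c)
  with incident-step a k c a<c a≤k k≤c
... | j , at-k , a≤j , j<c = suc j , Sum.map (cong suc) (cong suc) at-k , s≤s a≤j , s≤s j<c

least : ∀ {N} {Q : Fin N → Set} → (∀ i → Dec (Q i)) → ∃ Q → ∃[ i ] Q i × (∀ j → j <F i → ¬ Q j)
least {suc N} Q? witness with Q? zero
... | yes q₀ = zero , q₀ , λ _ ()
least {suc N} Q? (zero , q₀) | no ¬q₀ = ⊥-elim (¬q₀ q₀)
least {suc N} Q? (suc i , qᵢ) | no ¬q₀ with least (Q? ∘ suc) (i , qᵢ)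
... | j , qⱼ , below = suc j , qⱼ , λ { zero _ → ¬q₀ ; (suc i') i'<j → below i' (s≤s⁻¹ i'<j) }

-- Walks x → z through the vertices vs (x excluded), and walks with distinct
-- vertices, read as the sequence  lookup (x ∷ vs).
module SimpleWalks {A : Set} (_≟_ : DecidableEquality A) where
  open import Data.List.Membership.DecPropositional _≟_ using (_∈?_)

  data Walk (R : A → A → Set) : A → A → List A → Set where
    nil  : ∀ {x} → Walk R x x []
    cons : ∀ {x y z vs} → R x y → Walk R y z vs → Walk R x z (y ∷ vs)

  Distinct : List A → Set
  Distinct []       = ⊤
  Distinct (x ∷ xs) = x ∉ xs × Distinct xs

  lookup-injective : ∀ xs → Distinct xs → Injective _≡_ _≡_ (lookup xs)
  lookup-injective (x ∷ xs) _ {zero} {zero} _ = refl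
  lookup-injective (x ∷ xs) (x∉ , _) {zero} {suc j} eq = ⊥-elim (x∉ (subst (_∈ xs) (≡.sym eq) (∈-lookup j)))
  lookup-injective (x ∷ xs) (x∉ , _) {suc i} {zero} eq = ⊥-elim (x∉ (subst (_∈ xs) eq (∈-lookup i)))
  lookup-injective (x ∷ xs) (_ , d) {suc i} {suc j} eq = cong suc (lookup-injective xs d eq)

  module _ {R : A → A → Set} where
    suffix : ∀ {x y z vs} → x ∈ y ∷ vs → Walk R y z vs → Distinct (y ∷ vs) →
             ∃[ ws ] Walk R x z ws × Distinct (x ∷ ws)
    suffix (here refl) w d = _ , w , d
    suffix (there ()) nil _
    suffix (there x∈) (cons _ w) (_ , d) = suffix x∈ w d

    shortcut : ∀ {x z} → Star R x z → ∃[ vs ] Walk R x z vs × Distinct (x ∷ vs)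
    shortcut ε = [] , nil , (λ ()) , tt
    shortcut {x} (_◅_ {j = y} r rs) with shortcut rs
    ... | vs , w , d with x ∈? y ∷ vs
    ... | yes x∈ = suffix x∈ w d
    ... | no x∉  = y ∷ vs , cons r w , x∉ , d

    lookup-step : ∀ {x z vs} → Walk R x z vs → (j : Fin (length vs)) →
                  R (lookup (x ∷ vs) (inject₁ j)) (lookup (x ∷ vs) (suc j))
    lookup-step (cons r _) zero    = r
    lookup-step (cons _ w) (suc j) = lookup-step w j

    lookup-last : ∀ {x z vs} → Walk R x z vs → lookup (x ∷ vs) (fromℕ (length vs)) ≡ z
    lookup-last nil        = refl
    lookup-last (cons _ w) = lookup-last w

    restrict : ∀ {Q : A → Set} {x z vs} → Walk R x z vs → (∀ {e} → e ∈ x ∷ vs → Q e) →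
               Star (λ a b → R a b × Q a × Q b) x z
    restrict nil        _ = ε
    restrict (cons r w) q = (r , q (here refl) , q (there (here refl))) ◅ restrict w (q ∘ there)

module GraphWalks {m : ℕ} (T : Graph m) where
  open SimpleWalks (Fin._≟_ {m})

  edge-sym : ∀ {a b} → Edge T a b → Edge T b a
  edge-sym {a} {b} e = trans (sym T b a) e

  no-loop : ∀ {u} → ¬ Edge T u u
  no-loop {u} e with trans (≡.sym e) (irrefl T u)
  ... | ()

  SameEdge : Fin m → Fin m → Fin m → Fin m → Set
  SameEdge u v a b = (a ≡ u × b ≡ v) ⊎ (b ≡ u × a ≡ v)

  Avoiding : Fin m → Fin m → Fin m → Fin m → Set
  Avoiding u v a b = Edge T a b × ¬ SameEdge u v a b

  avoiding-sym : ∀ {u v a b} → Avoiding u v a b → Avoiding u v b a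
  avoiding-sym (e , other) = edge-sym e , other ∘ Sum.swap

  not-incident : ∀ {u v w a b} → w ≡ u ⊎ w ≡ v → a ≢ w → b ≢ w → ¬ SameEdge u v a b
  not-incident (inj₁ refl) a≢w _ (inj₁ (a≡w , _)) = a≢w a≡w
  not-incident (inj₁ refl) _ b≢w (inj₂ (b≡w , _)) = b≢w b≡w
  not-incident (inj₂ refl) _ b≢w (inj₁ (_ , b≡w)) = b≢w b≡w
  not-incident (inj₂ refl) a≢w _ (inj₂ (_ , a≡w)) = a≢w a≡w

  on-path : ∀ {x z vs e} → Walk (Edge T) x z vs → Distinct (x ∷ vs) → e ∈ x ∷ vs → OnPath T x z e
  on-path {x} {vs = vs} w d e∈ =
    length vs , lookup (x ∷ vs) , (lookup-injective _ d , lookup-step w) ,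
    refl , lookup-last w , index e∈ , ≡.sym (lookup-index e∈)

  -- In an acyclic graph no walk joins the ends of an edge without using it:
  -- a shortest such walk has at least two steps and closes a cycle with the edge.
  bridge : Acyclic T → ∀ {u v} → Edge T u v → ¬ Star (Avoiding u v) u v
  bridge acyclic {u} {v} uv walk with shortcut walk
  ... | [] , nil , _ = no-loop uv
  ... | _ ∷ [] , cons (_ , other) nil , _ = other (inj₁ (refl , refl))
  ... | v₁ ∷ v₂ ∷ vs , w , d =
    acyclic (length vs) (lookup (u ∷ v₁ ∷ v₂ ∷ vs))
      (lookup-injective _ d , proj₁ ∘ lookup-step w ,
       subst (λ x → Edge T x u) (≡.sym (lookup-last w)) (edge-sym uv))

module AlongPath {n m ℓ : ℕ} {G : Graph n} {T : Graph m} (D : TreeDecomp G T)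
                 (p : Fin (suc ℓ) → Fin m) (pathP : IsPath T p) where
  open SimpleWalks (Fin._≟_ {m})
  open GraphWalks T

  _∈bag_ : Fin n → Fin m → Set
  y ∈bag t = bag D t y ≡ true

  InT : Fin (suc ℓ) → Fin m → Set
  InT = InTᵢ D p

  RS : Fin (suc ℓ) → Fin n → Set
  RS = InRSᵢ D p

  PathEdge : Fin ℓ → Fin m → Fin m → Set
  PathEdge j = SameEdge (p (inject₁ j)) (p (suc j))

  OffEdge : Fin ℓ → Fin m → Fin m → Set
  OffEdge j = Avoiding (p (inject₁ j)) (p (suc j))

  -- P has distinct nodes, so its edges at distinct indices are distinct
  path-edge-index : ∀ {h j} → PathEdge j (p (inject₁ h)) (p (suc h)) → h ≡ j
  path-edge-index (inj₁ (same , _)) = Fin.inject₁-injective (proj₁ pathP same)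
  path-edge-index {h} {j} (inj₂ (after , before)) = ⊥-elim (<-asym h<j j<h)
    where
      h<j : toℕ h < toℕ j
      h<j = subst (suc (toℕ h) ≤_) (Fin.toℕ-inject₁ j) (≤-reflexive (cong toℕ (proj₁ pathP after)))
      j<h : toℕ j < toℕ h
      j<h = subst (suc (toℕ j) ≤_) (Fin.toℕ-inject₁ h) (≤-reflexive (cong toℕ (proj₁ pathP (≡.sym before))))

  off-path-edge : ∀ {h j} → h ≢ j → OffEdge j (p (inject₁ h)) (p (suc h))
  off-path-edge {h} h≢j = proj₂ pathP h , h≢j ∘ path-edge-index

  component-walk : ∀ {j a s} → InT a s → Star (OffEdge j) (p a) s
  component-walk {j} = ⋆.map λ (e , notP) → e , λ same → notP (j , same)

  -- Removing the j-th edge of P separates T_a from T_c when a ≤ j < c: P from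
  -- p j down to p a, T_a, the walk, T_c and P from p c down to p (j+1) would
  -- join the ends of that edge without using it.
  crossing : ∀ (j : Fin ℓ) {a c s t} → toℕ a ≤ toℕ j → toℕ j < toℕ c →
             InT a s → InT c t → ¬ Star (OffEdge j) s t
  crossing j {a} {c} a≤j j<c sa tc walk =
    bridge (proj₂ (isTree D)) (proj₂ pathP j)
      (down ◅◅ component-walk sa ◅◅ walk ◅◅ ⋆.reverse avoiding-sym (component-walk tc) ◅◅ up)
    where
      down : Star (OffEdge j) (p (inject₁ j)) (p a)
      down = ⋆.reverse avoiding-sym
        (climb p a (inject₁ j) (subst (toℕ a ≤_) (≡.sym (Fin.toℕ-inject₁ j)) a≤j)
          λ h _ h<j → off-path-edge λ { refl → <-irrefl (≡.sym (Fin.toℕ-inject₁ h)) h<j })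
      up : Star (OffEdge j) (p c) (p (suc j))
      up = ⋆.reverse avoiding-sym
        (climb p (suc j) c j<c λ h j<h _ → off-path-edge λ { refl → <-irrefl refl j<h })

  bag-walk : ∀ {y s t} → y ∈bag s → y ∈bag t → Star (λ a b → Edge T a b × y ∈bag a × y ∈bag b) s t
  bag-walk {y} {s} {t} ys yt with shortcut (proj₁ (isTree D) s t)
  ... | _ , w , d = restrict w λ e∈ → coherent D s t _ (on-path w d e∈) y ys yt

  -- if y ∉ X^{p k}, its bags cannot lie in components T_a, T_c with a ≤ k ≤ c, a < c:
  -- the walk between them misses p k, hence an edge of P at p k between a and c
  no-jump : ∀ {y s t a c} k → ¬ y ∈bag p k → y ∈bag s → InT a s → y ∈bag t → InT c t →
            toℕ a < toℕ c → toℕ a ≤ toℕ k → toℕ k ≤ toℕ c → ⊥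
  no-jump {y} {a = a} {c} k y∉ ys sa yt tc a<c a≤k k≤c with incident-step a k c a<c a≤k k≤c
  ... | j , at-k , a≤j , j<c = crossing j a≤j j<c sa tc (⋆.map off (bag-walk ys yt))
    where
      apart : ∀ {x} → y ∈bag x → x ≢ p k
      apart yx refl = y∉ yx
      off : ∀ {x z} → Edge T x z × y ∈bag x × y ∈bag z → OffEdge j x z
      off (e , yx , yz) =
        e , not-incident (Sum.map (cong p ∘ ≡.sym) (cong p ∘ ≡.sym) at-k) (apart yx) (apart yz)

  module _ {y s t a c} (k : Fin (suc ℓ)) (y∉ : ¬ y ∈bag p k)
           (ys : y ∈bag s) (sa : InT a s) (yt : y ∈bag t) (tc : InT c t) where
    stays-below : a <F k → c <F k
    stays-below a<k with toℕ c <? toℕ k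
    ... | yes c<k = c<k
    ... | no c≮k = ⊥-elim (no-jump k y∉ ys sa yt tc (<-≤-trans a<k (≮⇒≥ c≮k)) (<⇒≤ a<k) (≮⇒≥ c≮k))

    stays-above : k <F a → k <F c
    stays-above k<a with toℕ k <? toℕ c
    ... | yes k<c = k<c
    ... | no k≮c = ⊥-elim (no-jump k y∉ yt tc ys sa (≤-<-trans (≮⇒≥ k≮c) k<a) (≮⇒≥ k≮c) (<⇒≤ k<a))

    stays-at : a ≡ k → c ≡ k
    stays-at refl with Fin.<-cmp c a
    ... | tri< c<a _ _ = ⊥-elim (no-jump k y∉ yt tc ys sa c<a (<⇒≤ c<a) ≤-refl)
    ... | tri≈ _ c≡a _ = c≡a
    ... | tri> _ _ a<c = ⊥-elim (no-jump k y∉ ys sa yt tc a<c ≤-refl (<⇒≤ a<c))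

  -- every node of T lies in some component T_c: follow a walk from p 0,
  -- restarting at every node of P
  component : ∀ t → ∃[ c ] InT c t
  component t = extend (proj₁ (isTree D) (p zero) t) (zero , ε)
    where
      step : ∀ {x u} → Edge T x u → ∃[ c ] InT c x → ∃[ c ] InT c u
      step {u = u} e (c , xc) with Fin.any? (λ c' → p c' Fin.≟ u)
      ... | yes (c' , refl) = c' , ε
      ... | no notOnP = c , xc ◅◅ (e , notOnP ∘ path-edge-end) ◅ ε
        where
          path-edge-end : ∀ {x} → PEdge D p x u → ∃[ c' ] p c' ≡ u
          path-edge-end (j , inj₁ (_ , u≡)) = suc j , ≡.sym u≡
          path-edge-end (j , inj₂ (u≡ , _)) = inject₁ j , ≡.sym u≡
      extend : ∀ {x u} → Star (Edge T) x u → ∃[ c ] InT c x → ∃[ c ] InT c u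
      extend ε found = found
      extend (e ◅ es) found = extend es (step e found)

  -- every vertex lies in a block R_a ∪ S_a: in R_a for the first a with
  -- v ∈ X^{p a}, otherwise in S_c for the component of a bag containing v
  block : ∀ v → ∃[ a ] RS a v
  block v with Fin.any? (λ c → bag D (p c) v Bool.≟ true)
  ... | yes inR = let (a , va , first) = least (λ c → bag D (p c) v Bool.≟ true) inR
                  in a , inj₁ (va , first)
  ... | no notR = let (t , vt) = cover-v D v ; (c , tc) = component t
                  in c , inj₂ ((t , tc , vt) , notR)

  home : ∀ {a v} → RS a v → ∃[ s ] InT a s × v ∈bag s
  home {a} (inj₁ (va , _)) = p a , ε , va
  home (inj₂ ((s , sa , vs) , _)) = s , sa , vs

  outside-R : ∀ {k v} → RS k v → ¬ v ∈bag p k → InSᵢ D p k v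
  outside-R (inj₁ (vk , _)) v∉ = ⊥-elim (v∉ vk)
  outside-R (inj₂ vS) _ = vS

  -- An edge uv of G − E_G(p k) lies in a bag of some T_c; the homes of u and v
  -- are on the same side of k as c, so the edge stays in S_k, before or after k.
  edges-inside : ∀ k u v → EdgeMinus D p k u v →
                 (InSᵢ D p k u × InSᵢ D p k v) ⊎ (Before D p k u × Before D p k v)
                 ⊎ (After D p k u × After D p k v)
  edges-inside k u v (uv , u∉ , v∉) with cover-e D u v uv | block u | block v
  ... | t , ut , vt | a , ua | b , vb with component t | home ua | home vb
  ... | c , tc | su , sua , usu | sv , svb , vsv with Fin.<-cmp a k
  ... | tri< a<k _ _ =
    inj₂ (inj₁ ((a , a<k , ua) , (b , stays-below k v∉ vt tc vsv svb (stays-below k u∉ usu sua ut tc a<k) , vb)))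
  ... | tri≈ _ refl _ =
    inj₁ (outside-R ua u∉ , outside-R (subst (λ i → RS i v) b≡k vb) v∉)
    where b≡k = stays-at k v∉ vt tc vsv svb (stays-at k u∉ usu sua ut tc refl)
  ... | tri> _ _ k<a =
    inj₂ (inj₂ ((a , k<a , ua) , (b , stays-above k v∉ vt tc vsv svb (stays-above k u∉ usu sua ut tc k<a) , vb)))

  module Labelled (lab : Fin n → Fin n) (L : IsPLabeling D p lab) where
    open IsPLabeling L

    block-unique : ∀ {a b v} → RS a v → RS b v → a ≡ b
    block-unique {a} {b} {v} va vb with Fin.<-cmp a b
    ... | tri< a<b _ _ = ⊥-elim (<-irrefl refl (ordered a b a<b v v va vb))
    ... | tri≈ _ a≡b _ = a≡b
    ... | tri> _ _ b<a = ⊥-elim (<-irrefl refl (ordered b a b<a v v vb va))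

    not-before : ∀ {k v} → RS k v → ¬ Before D p k v
    not-before vk (a , a<k , va) = <-irrefl (cong toℕ (block-unique va vk)) a<k

    not-after : ∀ {k v} → RS k v → ¬ After D p k v
    not-after vk (a , k<a , va) = <-irrefl (cong toℕ (block-unique vk va)) k<a

    before-after : ∀ {k v} → Before D p k v → ¬ After D p k v
    before-after (a , a<k , va) (b , k<b , vb) = <-irrefl (cong toℕ (block-unique va vb)) (<-trans a<k k<b)

    cover : ∀ k v → InRᵢ D p k v ⊎ InSᵢ D p k v ⊎ Before D p k v ⊎ After D p k v
    cover k v with block v
    ... | a , va with Fin.<-cmp a k
    ... | tri< a<k _ _ = inj₂ (inj₂ (inj₁ (a , a<k , va)))
    ... | tri≈ _ refl _ = Sum.map₂ inj₁ va
    ... | tri> _ _ k<a = inj₂ (inj₂ (inj₂ (a , k<a , va)))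

    -- labels grow with the block, and within a block those of R come last
    below-max : ∀ {i x a v} → InRᵢ D p i x → (∀ y → InRᵢ D p i y → lab y ≤F lab x) →
                RS a v → toℕ a ≤ toℕ i → lab v ≤F lab x
    below-max {i} {x} {a} {v} xi max va a≤i with Fin.<-cmp a i
    ... | tri< a<i _ _ = <⇒≤ (ordered a i a<i v x va (inj₁ xi))
    ... | tri≈ _ refl _ = [ max v , <⇒≤ ∘ R-largest a x v xi ]′ va
    ... | tri> _ _ i<a = ⊥-elim (<⇒≱ i<a a≤i)

    above-min : ∀ {i x a v} → RS i x → (∀ y → RS i y → lab x ≤F lab y) →
                RS a v → toℕ i ≤ toℕ a → lab x ≤F lab v
    above-min {i} {x} {a} {v} xi min va i≤a with Fin.<-cmp i a
    ... | tri< i<a _ _ = <⇒≤ (ordered i a i<a x v xi va)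
    ... | tri≈ _ refl _ = min v va
    ... | tri> _ _ a<i = ⊥-elim (<⇒≱ a<i i≤a)

    block-order : ∀ {i x a v} → RS i x → RS a v → lab v ≤F lab x → toℕ a ≤ toℕ i
    block-order {i} {x} {a} {v} xi va v≤x = ≮⇒≥ λ i<a → <⇒≱ (ordered i a i<a x v xi va) v≤x

    before-interval : ∀ k (k₀ : Fin ℓ) → k ≡ suc k₀ → ∀ x → InRᵢ D p (inject₁ k₀) x →
                      (∀ y → InRᵢ D p (inject₁ k₀) y → lab y ≤F lab x) →
                      ∀ v → (Before D p k v → lab v ≤F lab x) × (lab v ≤F lab x → Before D p k v)
    before-interval _ k₀ refl x xi max v =
      (λ (a , a<k , va) → below-max xi max va (subst (toℕ a ≤_) (≡.sym e) (s≤s⁻¹ a<k))) ,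
      (λ v≤x → let (a , va) = block v in a , s≤s (subst (toℕ a ≤_) e (block-order (inj₁ xi) va v≤x)) , va)
      where e = Fin.toℕ-inject₁ k₀

    after-interval : ∀ k (k₀ : Fin ℓ) → k ≡ inject₁ k₀ → ∀ x → InRSᵢ D p (suc k₀) x →
                     (∀ y → InRSᵢ D p (suc k₀) y → lab x ≤F lab y) →
                     ∀ v → (After D p k v → lab x ≤F lab v) × (lab x ≤F lab v → After D p k v)
    after-interval _ k₀ refl x xi min v =
      (λ (a , k<a , va) → above-min xi min va (subst (_< toℕ a) e k<a)) ,
      (λ x≤v → let (a , va) = block v in a , subst (_< toℕ a) (≡.sym e) (block-order va xi x≤v) , va)
      where e = Fin.toℕ-inject₁ k₀

proposition4p4 : ∀ {n m ℓ : ℕ} (G : Graph n) (T : Graph m)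
                 (D : TreeDecomp G T) (p : Fin (suc ℓ) → Fin m) →
                 IsPath T p → NonredundantEnd D p →
                 (lab : Fin n → Fin n) → IsPLabeling D p lab →
                 (k : Fin (suc ℓ)) → Decomposition D p lab k
proposition4p4 G T D p pathP _ lab L k = record
  { cover           = cover k
  ; disj-R-S        = λ v (vR , _ , notR) → notR (k , proj₁ vR)
  ; disj-R-B        = λ v (vR , before) → not-before (inj₁ vR) before
  ; disj-R-A        = λ v (vR , after) → not-after (inj₁ vR) after
  ; disj-S-B        = λ v (vS , before) → not-before (inj₂ vS) before
  ; disj-S-A        = λ v (vS , after) → not-after (inj₂ vS) after
  ; disj-B-A        = λ v (before , after) → before-after before after
  ; R-isolated      = λ v u vR (_ , v∉ , _) → v∉ (proj₁ vR)
  ; edges-inside    = edges-inside k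
  ; before-interval = before-interval k
  ; after-interval  = after-interval k
  }
  where
    open AlongPath D p pathP
    open Labelled lab L
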